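{- Let $\beta,\gamma$ be non-negative integers with $(\beta,\gamma)\neq(0,0)$, and let $H_n(\beta,\gamma)$ denote the coefficient of $\frac{x^n}{n!}$ in $\frac{e^{\gamma x}}{2-e^{\beta x}}$. Then for every $n\ge0$, $$H_{n+1}(\beta,\gamma)=\gamma H_n(\beta,\gamma)+\beta\sum_{i=0}^{n}\binom{n}{i}H_i(\beta,\gamma)H_{n-i}(\beta,\beta).$$ -}

module Defs where

open import Data.Nat using (ℕ; zero; suc; _∸_; _^_)
open import Data.Nat.Combinatorics using (_C_)
open import Data.Integer using (ℤ; +_; -_; _*_; _+_; _-_)
open import Data.List using (map; upTo; foldr)
open import Relation.Binary.PropositionalEquality using (_≡_)

-- An exponential generating function (formal power series) over ℤ,
-- represented by its sequence of coefficients: f n is the coefficient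
-- of x^n / n!.
EGF : Set
EGF = ℕ → ℤ

Σ≤ : ℕ → (ℕ → ℤ) → ℤ
Σ≤ n f = foldr _+_ (+ 0) (map f (upTo (suc n)))

-- Product of EGFs: binomial convolution.
_⊛_ : EGF → EGF → EGF
(f ⊛ g) n = Σ≤ n (λ i → + (n C i) * f i * g (n ∸ i))

expE : ℕ → EGF
expE c n = + (c ^ n)

constE : ℤ → EGF
constE c zero    = c
constE c (suc _) = + 0

_⊖_ : EGF → EGF → EGF
(f ⊖ g) n = f n - g n

twoMinusExp : ℕ → EGF
twoMinusExp β = constE (+ 2) ⊖ expE β

-- h is the quotient num / den in the ring of formal power series,
-- i.e. h * den = num  (den will have constant term 1, so h is unique).
IsQuotient : EGF → EGF → EGF → Set
IsQuotient h num den = ∀ n → (h ⊛ den) n ≡ num n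

-- Write D = 2 - e^{βx}, so that D' = -β e^{βx}.  Differentiating H D = e^{γx} gives
-- H' D = γ e^{γx} - H D' = γ e^{γx} + β H e^{βx}, and the second hypothesis rewrites
-- e^{βx} = Hββ D, so H' D = (γ H + β H Hββ) D.  Since D has constant term 1 it can be
-- cancelled, which gives H' = γ H + β H Hββ; its coefficient of x^n/n! is the recurrence.
module Submission where

open import Defs
open import Data.Nat using (ℕ; zero; suc; _∸_; _^_; _≤_; _<_; z≤n; s≤s)
open import Data.Nat.Combinatorics using (_C_; nCn≡1; nCk+nC[k+1]≡[n+1]C[k+1])
open import Data.Nat.Combinatorics.Specification using (k>n⇒nCk≡0)
open import Data.Nat.Induction using (<-rec)
open import Data.Nat.Properties using (n<1+n; n∸n≡0; +-∸-assoc)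
open import Data.Integer using (ℤ; +_; -_; _*_; _+_; _-_)
open import Data.Integer.Properties
  using (+-identityˡ; +-identityʳ; +-assoc; *-identityˡ; *-identityʳ; *-zeroʳ; *-assoc; *-distribˡ-+;
         +-inverseʳ; i-j≡0⇒i≡j; pos-*; neg-distribˡ-*)
open import Data.Integer.Tactic.RingSolver using (solve-∀)
open import Data.List using ([]; _∷_; foldr; map; upTo)
open import Data.List.Properties using (map-applyUpTo; map-upTo)
open import Data.Product using (_×_)
open import Function using (_∘_)
open import Relation.Nullary using (¬_)
open import Relation.Binary.PropositionalEquality
  using (_≡_; _≗_; refl; sym; trans; cong; cong₂; module ≡-Reasoning)
open ≡-Reasoning

Σ≤-suc : ∀ n f → Σ≤ (suc n) f ≡ f 0 + Σ≤ n (f ∘ suc)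
Σ≤-suc n f = cong (λ xs → f 0 + foldr _+_ (+ 0) xs)
  (trans (map-applyUpTo suc f (suc n)) (sym (map-upTo (f ∘ suc) (suc n))))

Σ≤-snoc : ∀ n f → Σ≤ (suc n) f ≡ Σ≤ n f + f (suc n)
Σ≤-snoc zero f = trans (cong (_+_ (f 0)) (+-identityʳ (f 1))) (cong (_+ f 1) (sym (+-identityʳ (f 0))))
Σ≤-snoc (suc n) f = begin
  Σ≤ (suc (suc n)) f                        ≡⟨ Σ≤-suc (suc n) f ⟩
  f 0 + Σ≤ (suc n) (f ∘ suc)                ≡⟨ cong (_+_ (f 0)) (Σ≤-snoc n (f ∘ suc)) ⟩
  f 0 + (Σ≤ n (f ∘ suc) + f (suc (suc n)))  ≡⟨ assoc (f 0) _ _ ⟩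
  f 0 + Σ≤ n (f ∘ suc) + f (suc (suc n))    ≡⟨ cong (_+ f (suc (suc n))) (Σ≤-suc n f) ⟨
  Σ≤ (suc n) f + f (suc (suc n))            ∎
  where
  assoc : ∀ a b c → a + (b + c) ≡ a + b + c
  assoc = solve-∀

Σ≤-cong : ∀ n {f g : ℕ → ℤ} → (∀ i → i ≤ n → f i ≡ g i) → Σ≤ n f ≡ Σ≤ n g
Σ≤-cong zero f≡g = cong (_+ + 0) (f≡g 0 z≤n)
Σ≤-cong (suc n) {f} {g} f≡g = begin
  Σ≤ (suc n) f                ≡⟨ Σ≤-suc n f ⟩
  f 0 + Σ≤ n (f ∘ suc)        ≡⟨ cong₂ _+_ (f≡g 0 z≤n) (Σ≤-cong n (λ i i≤n → f≡g (suc i) (s≤s i≤n))) ⟩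
  g 0 + Σ≤ n (g ∘ suc)        ≡⟨ Σ≤-suc n g ⟨
  Σ≤ (suc n) g                ∎

Σ≤-zero : ∀ n {f : ℕ → ℤ} → (∀ i → i ≤ n → f i ≡ + 0) → Σ≤ n f ≡ + 0
Σ≤-zero n {f} f≡0 = trans (Σ≤-cong n f≡0) (Σ-over-zero (upTo (suc n)))
  where
  Σ-over-zero : ∀ xs → foldr _+_ (+ 0) (map (λ _ → + 0) xs) ≡ + 0
  Σ-over-zero [] = refl
  Σ-over-zero (_ ∷ xs) = cong (_+_ (+ 0)) (Σ-over-zero xs)

Σ≤-distrib-+ : ∀ n f g → Σ≤ n (λ i → f i + g i) ≡ Σ≤ n f + Σ≤ n g
Σ≤-distrib-+ n f g = go (upTo (suc n))
  where
  interchange : ∀ a b c d → a + b + (c + d) ≡ a + c + (b + d)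
  interchange = solve-∀
  go : ∀ xs → foldr _+_ (+ 0) (map (λ i → f i + g i) xs)
            ≡ foldr _+_ (+ 0) (map f xs) + foldr _+_ (+ 0) (map g xs)
  go [] = refl
  go (x ∷ xs) = trans (cong (_+_ (f x + g x)) (go xs)) (interchange (f x) (g x) _ _)

Σ≤-distrib-- : ∀ n f g → Σ≤ n (λ i → f i - g i) ≡ Σ≤ n f - Σ≤ n g
Σ≤-distrib-- n f g = go (upTo (suc n))
  where
  interchange : ∀ a b c d → a - b + (c - d) ≡ a + c - (b + d)
  interchange = solve-∀
  go : ∀ xs → foldr _+_ (+ 0) (map (λ i → f i - g i) xs)
            ≡ foldr _+_ (+ 0) (map f xs) - foldr _+_ (+ 0) (map g xs)
  go [] = refl
  go (x ∷ xs) = trans (cong (_+_ (f x - g x)) (go xs)) (interchange (f x) (g x) _ _)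

*-distribˡ-Σ≤ : ∀ c n f → c * Σ≤ n f ≡ Σ≤ n (λ i → c * f i)
*-distribˡ-Σ≤ c n f = go (upTo (suc n))
  where
  go : ∀ xs → c * foldr _+_ (+ 0) (map f xs) ≡ foldr _+_ (+ 0) (map (λ i → c * f i) xs)
  go [] = *-zeroʳ c
  go (x ∷ xs) = trans (*-distribˡ-+ c (f x) _) (cong (_+_ (c * f x)) (go xs))

infixl 6 _⊕_
infixr 7 _·_

_⊕_ : EGF → EGF → EGF
(f ⊕ g) n = f n + g n

_·_ : ℤ → EGF → EGF
(c · f) n = c * f n

⊛-term : EGF → EGF → ℕ → ℕ → ℤ
⊛-term f g n i = + (n C i) * f i * g (n ∸ i)

-- On exponential generating functions the derivative is the shift of coefficients.
∂ : EGF → EGF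
∂ f n = f (suc n)

⊛-cong : ∀ {f f′ g g′} → f ≗ f′ → g ≗ g′ → f ⊛ g ≗ f′ ⊛ g′
⊛-cong f≗f′ g≗g′ n = Σ≤-cong n (λ i _ → cong₂ (λ a b → + (n C i) * a * b) (f≗f′ i) (g≗g′ (n ∸ i)))

⊛-distribʳ-⊕ : ∀ f g h → (f ⊕ g) ⊛ h ≗ (f ⊛ h) ⊕ (g ⊛ h)
⊛-distribʳ-⊕ f g h n = trans (Σ≤-cong n (λ i _ → distrib (+ (n C i)) (f i) (g i) (h (n ∸ i))))
                             (Σ≤-distrib-+ n (⊛-term f h n) (⊛-term g h n))
  where
  distrib : ∀ c a b d → c * (a + b) * d ≡ c * a * d + c * b * d
  distrib = solve-∀

⊛-distribˡ-⊕ : ∀ f g h → f ⊛ (g ⊕ h) ≗ (f ⊛ g) ⊕ (f ⊛ h)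
⊛-distribˡ-⊕ f g h n = trans (Σ≤-cong n (λ i _ → *-distribˡ-+ (+ (n C i) * f i) (g (n ∸ i)) (h (n ∸ i))))
                             (Σ≤-distrib-+ n (⊛-term f g n) (⊛-term f h n))

⊛-distribʳ-⊖ : ∀ f g h → (f ⊖ g) ⊛ h ≗ (f ⊛ h) ⊖ (g ⊛ h)
⊛-distribʳ-⊖ f g h n = trans (Σ≤-cong n (λ i _ → distrib (+ (n C i)) (f i) (g i) (h (n ∸ i))))
                             (Σ≤-distrib-- n (⊛-term f h n) (⊛-term g h n))
  where
  distrib : ∀ c a b d → c * (a - b) * d ≡ c * a * d - c * b * d
  distrib = solve-∀

⊛-·ˡ : ∀ c f g → (c · f) ⊛ g ≗ c · (f ⊛ g)
⊛-·ˡ c f g n = trans (Σ≤-cong n (λ i _ → pull c (+ (n C i)) (f i) (g (n ∸ i))))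
                     (sym (*-distribˡ-Σ≤ c n (⊛-term f g n)))
  where
  pull : ∀ c k a b → k * (c * a) * b ≡ c * (k * a * b)
  pull = solve-∀

⊛-·ʳ : ∀ c f g → f ⊛ (c · g) ≗ c · (f ⊛ g)
⊛-·ʳ c f g n = trans (Σ≤-cong n (λ i _ → pull c (+ (n C i)) (f i) (g (n ∸ i))))
                     (sym (*-distribˡ-Σ≤ c n (⊛-term f g n)))
  where
  pull : ∀ c k a b → k * a * (c * b) ≡ c * (k * a * b)
  pull = solve-∀

⊛-at-0 : ∀ f g → (f ⊛ g) 0 ≡ f 0 * g 0
⊛-at-0 f g = trans (+-identityʳ _) (cong (_* g 0) (*-identityˡ (f 0)))

∂-⊛ : ∀ f g → ∂ (f ⊛ g) ≗ (∂ f ⊛ g) ⊕ (f ⊛ ∂ g)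
∂-⊛ f g n = begin
  (f ⊛ g) (suc n)                               ≡⟨ Σ≤-suc n (⊛-term f g (suc n)) ⟩
  t 0 + Σ≤ n (⊛-term f g (suc n) ∘ suc)         ≡⟨ cong (_+_ (t 0)) pascal-split ⟩
  t 0 + ((∂ f ⊛ g) n + Σ≤ n (t ∘ suc))          ≡⟨ swap (t 0) ((∂ f ⊛ g) n) _ ⟩
  (∂ f ⊛ g) n + (t 0 + Σ≤ n (t ∘ suc))          ≡⟨ cong (_+_ ((∂ f ⊛ g) n)) reindex ⟩
  (∂ f ⊛ g) n + (f ⊛ ∂ g) n                     ∎
  where
  t : ℕ → ℤ
  t i = + (n C i) * f i * g (suc n ∸ i)

  swap : ∀ x a b → x + (a + b) ≡ a + (x + b)
  swap = solve-∀
  distrib : ∀ c d a b → (c + d) * a * b ≡ c * a * b + d * a * b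
  distrib = solve-∀

  pascal : ∀ j → ⊛-term f g (suc n) (suc j) ≡ ⊛-term (∂ f) g n j + t (suc j)
  pascal j = trans (cong (λ c → + c * f (suc j) * g (n ∸ j)) (sym (nCk+nC[k+1]≡[n+1]C[k+1] n j)))
                   (distrib (+ (n C j)) (+ (n C suc j)) (f (suc j)) (g (n ∸ j)))

  pascal-split : Σ≤ n (⊛-term f g (suc n) ∘ suc) ≡ (∂ f ⊛ g) n + Σ≤ n (t ∘ suc)
  pascal-split = trans (Σ≤-cong n (λ j _ → pascal j)) (Σ≤-distrib-+ n (⊛-term (∂ f) g n) (t ∘ suc))

  -- The sum over i ≤ n + 1 of t i is (f ⊛ ∂ g) n extended by the term n C (n + 1) = 0.
  reindex : t 0 + Σ≤ n (t ∘ suc) ≡ (f ⊛ ∂ g) n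
  reindex = begin
    t 0 + Σ≤ n (t ∘ suc) ≡⟨ Σ≤-suc n t ⟨
    Σ≤ (suc n) t         ≡⟨ Σ≤-snoc n t ⟩
    Σ≤ n t + t (suc n)   ≡⟨ cong (λ c → Σ≤ n t + + c * f (suc n) * g (n ∸ n)) (k>n⇒nCk≡0 (n<1+n n)) ⟩
    Σ≤ n t + + 0         ≡⟨ +-identityʳ (Σ≤ n t) ⟩
    Σ≤ n t               ≡⟨ Σ≤-cong n (λ i i≤n → cong (λ k → + (n C i) * f i * g k) (+-∸-assoc 1 i≤n)) ⟩
    (f ⊛ ∂ g) n          ∎

⊛-assoc : ∀ f g h → (f ⊛ g) ⊛ h ≗ f ⊛ (g ⊛ h)
⊛-assoc f g h zero = begin
  ((f ⊛ g) ⊛ h) 0      ≡⟨ ⊛-at-0 (f ⊛ g) h ⟩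
  (f ⊛ g) 0 * h 0      ≡⟨ cong (_* h 0) (⊛-at-0 f g) ⟩
  f 0 * g 0 * h 0      ≡⟨ *-assoc (f 0) (g 0) (h 0) ⟩
  f 0 * (g 0 * h 0)    ≡⟨ cong (f 0 *_) (⊛-at-0 g h) ⟨
  f 0 * (g ⊛ h) 0      ≡⟨ ⊛-at-0 f (g ⊛ h) ⟨
  (f ⊛ (g ⊛ h)) 0      ∎
⊛-assoc f g h (suc n) = begin
  ((f ⊛ g) ⊛ h) (suc n)
    ≡⟨ ∂-⊛ (f ⊛ g) h n ⟩
  (∂ (f ⊛ g) ⊛ h) n + ((f ⊛ g) ⊛ ∂ h) n
    ≡⟨ cong (_+ ((f ⊛ g) ⊛ ∂ h) n) (trans (⊛-cong {g = h} (∂-⊛ f g) (λ _ → refl) n)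
                                          (⊛-distribʳ-⊕ (∂ f ⊛ g) (f ⊛ ∂ g) h n)) ⟩
  ((∂ f ⊛ g) ⊛ h) n + ((f ⊛ ∂ g) ⊛ h) n + ((f ⊛ g) ⊛ ∂ h) n
    ≡⟨ cong₂ _+_ (cong₂ _+_ (⊛-assoc (∂ f) g h n) (⊛-assoc f (∂ g) h n)) (⊛-assoc f g (∂ h) n) ⟩
  (∂ f ⊛ (g ⊛ h)) n + (f ⊛ (∂ g ⊛ h)) n + (f ⊛ (g ⊛ ∂ h)) n
    ≡⟨ +-assoc ((∂ f ⊛ (g ⊛ h)) n) _ _ ⟩
  (∂ f ⊛ (g ⊛ h)) n + ((f ⊛ (∂ g ⊛ h)) n + (f ⊛ (g ⊛ ∂ h)) n)
    ≡⟨ cong (_+_ ((∂ f ⊛ (g ⊛ h)) n)) (trans (⊛-cong {f = f} (λ _ → refl) (∂-⊛ g h) n)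
                                              (⊛-distribˡ-⊕ f (∂ g ⊛ h) (g ⊛ ∂ h) n)) ⟨
  (∂ f ⊛ (g ⊛ h)) n + (f ⊛ ∂ (g ⊛ h)) n
    ≡⟨ ∂-⊛ f (g ⊛ h) n ⟨
  (f ⊛ (g ⊛ h)) (suc n)
    ∎

⊛-leading : ∀ f g n → (∀ i → i < n → f i ≡ + 0) → (f ⊛ g) n ≡ f n * g 0
⊛-leading f g zero _ = ⊛-at-0 f g
⊛-leading f g (suc m) f<n≡0 = begin
  (f ⊛ g) (suc m)                                          ≡⟨ Σ≤-snoc m (⊛-term f g (suc m)) ⟩
  Σ≤ m (⊛-term f g (suc m)) + ⊛-term f g (suc m) (suc m)   ≡⟨ cong₂ _+_ lower-terms top-term ⟩
  + 0 + + 1 * f (suc m) * g 0                              ≡⟨ unit (f (suc m)) (g 0) ⟩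
  f (suc m) * g 0                                          ∎
  where
  vanish : ∀ c d → c * + 0 * d ≡ + 0
  vanish = solve-∀
  unit : ∀ a b → + 0 + + 1 * a * b ≡ a * b
  unit = solve-∀
  lower-terms : Σ≤ m (⊛-term f g (suc m)) ≡ + 0
  lower-terms = Σ≤-zero m (λ i i≤m →
    trans (cong (λ a → + (suc m C i) * a * g (suc m ∸ i)) (f<n≡0 i (s≤s i≤m)))
          (vanish (+ (suc m C i)) (g (suc m ∸ i))))
  top-term : ⊛-term f g (suc m) (suc m) ≡ + 1 * f (suc m) * g 0
  top-term = cong₂ (λ c k → + c * f (suc m) * g k) (nCn≡1 (suc m)) (n∸n≡0 m)

IsQuotient-unique : ∀ {num den f g} → den 0 ≡ + 1 →
                    IsQuotient f num den → IsQuotient g num den → f ≗ g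
IsQuotient-unique {num} {den} {f} {g} den₀≡1 f-quot g-quot n = i-j≡0⇒i≡j (f n) (g n) (vanish n)
  where
  annihilated : ∀ n → ((f ⊖ g) ⊛ den) n ≡ + 0
  annihilated n = begin
    ((f ⊖ g) ⊛ den) n          ≡⟨ ⊛-distribʳ-⊖ f g den n ⟩
    (f ⊛ den) n - (g ⊛ den) n  ≡⟨ cong₂ _-_ (f-quot n) (g-quot n) ⟩
    num n - num n              ≡⟨ +-inverseʳ (num n) ⟩
    + 0                        ∎
  vanish : ∀ n → (f ⊖ g) n ≡ + 0
  vanish = <-rec (λ n → (f ⊖ g) n ≡ + 0) λ n below → begin
    (f ⊖ g) n                ≡⟨ *-identityʳ ((f ⊖ g) n) ⟨
    (f ⊖ g) n * + 1          ≡⟨ cong (_*_ ((f ⊖ g) n)) den₀≡1 ⟨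
    (f ⊖ g) n * den 0        ≡⟨ ⊛-leading (f ⊖ g) den n (λ i i<n → below i<n) ⟨
    ((f ⊖ g) ⊛ den) n        ≡⟨ annihilated n ⟩
    + 0                      ∎

∂-IsQuotient : ∀ {h num den} → IsQuotient h num den → IsQuotient (∂ h) (∂ num ⊖ (h ⊛ ∂ den)) den
∂-IsQuotient {h} {num} {den} h-quot n = begin
  (∂ h ⊛ den) n                                  ≡⟨ cancel ((∂ h ⊛ den) n) ((h ⊛ ∂ den) n) ⟨
  (∂ h ⊛ den) n + (h ⊛ ∂ den) n - (h ⊛ ∂ den) n  ≡⟨ cong (_- (h ⊛ ∂ den) n) (∂-⊛ h den n) ⟨
  (h ⊛ den) (suc n) - (h ⊛ ∂ den) n              ≡⟨ cong (_- (h ⊛ ∂ den) n) (h-quot (suc n)) ⟩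
  num (suc n) - (h ⊛ ∂ den) n                    ∎
  where
  cancel : ∀ a b → a + b - b ≡ a
  cancel = solve-∀

∂-expE : ∀ c → ∂ (expE c) ≗ + c · expE c
∂-expE c n = pos-* c (c ^ n)

∂-twoMinusExp : ∀ β → ∂ (twoMinusExp β) ≗ (- + β) · expE β
∂-twoMinusExp β n = begin
  + 0 - + (β ^ suc n)       ≡⟨ +-identityˡ _ ⟩
  - + (β ^ suc n)           ≡⟨ cong -_ (∂-expE β n) ⟩
  - (+ β * + (β ^ n))       ≡⟨ neg-distribˡ-* (+ β) _ ⟩
  (- + β) * + (β ^ n)       ∎

theorem4 : (β γ : ℕ) → ¬ (β ≡ 0 × γ ≡ 0) →
    (H Hββ : EGF) →
    IsQuotient H (expE γ) (twoMinusExp β) →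
    IsQuotient Hββ (expE β) (twoMinusExp β) →
    ∀ n → H (suc n) ≡ + γ * H n + + β * Σ≤ n (λ i → + (n C i) * H i * Hββ (n ∸ i))
theorem4 β γ _ H Hββ H-quot Hββ-quot =
  IsQuotient-unique refl (∂-IsQuotient {H} {expE γ} {D} H-quot) rhs-quot
  where
  D : EGF
  D = twoMinusExp β
  flip-sign : ∀ a b x → a + b * x ≡ a - (- b) * x
  flip-sign = solve-∀
  rhs-quot : IsQuotient ((+ γ · H) ⊕ (+ β · (H ⊛ Hββ))) (∂ (expE γ) ⊖ (H ⊛ ∂ D)) D
  rhs-quot n = begin
    (((+ γ · H) ⊕ (+ β · (H ⊛ Hββ))) ⊛ D) n
      ≡⟨ ⊛-distribʳ-⊕ (+ γ · H) (+ β · (H ⊛ Hββ)) D n ⟩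
    ((+ γ · H) ⊛ D) n + ((+ β · (H ⊛ Hββ)) ⊛ D) n
      ≡⟨ cong₂ _+_ (⊛-·ˡ (+ γ) H D n) (⊛-·ˡ (+ β) (H ⊛ Hββ) D n) ⟩
    + γ * (H ⊛ D) n + + β * ((H ⊛ Hββ) ⊛ D) n
      ≡⟨ cong₂ (λ a b → + γ * a + + β * b) (H-quot n)
               (trans (⊛-assoc H Hββ D n) (⊛-cong {f = H} (λ _ → refl) Hββ-quot n)) ⟩
    + γ * expE γ n + + β * (H ⊛ expE β) n
      ≡⟨ flip-sign (+ γ * expE γ n) (+ β) ((H ⊛ expE β) n) ⟩
    + γ * expE γ n - (- + β) * (H ⊛ expE β) n
      ≡⟨ cong₂ _-_ (∂-expE γ n) (trans (⊛-cong {f = H} (λ _ → refl) (∂-twoMinusExp β) n)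
                                         (⊛-·ʳ (- + β) H (expE β) n)) ⟨
    (∂ (expE γ) ⊖ (H ⊛ ∂ D)) n
      ∎
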